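{- Let $n,m,l$ be non-negative integers with $m\le l<n/2$. Then $g_n(m,n-m)\le g_{n-1}(m,l)$, where for integers $0\le a\le b\le N$, $g_N(a,b)$ denotes the smallest integer $k\ge 0$ such that there exists a cutset in $2^{[N]}$ containing exactly $k$ subsets of size $i$ for each $a\le i\le b$ and no subsets of any other size.
   Context: $[N]=\{1,\dots,N\}$ and $2^{[N]}$ is the set of all subsets of $[N]$ ordered by inclusion. A maximal chain in $2^{[N]}$ is a chain $A_0 \subset A_1 \subset \cdots \subset A_N$ with $|A_i|=i$. A cutset is a collection $\mathcal{C}\subseteq 2^{[N]}$ that meets every maximal chain. -}

module Defs where

open import Data.Nat using (ℕ; zero; suc; _≤_; _<_; _*_; _∸_)
open import Data.Nat.Properties using (_≟_)
open import Data.Fin using (Fin; toℕ; inject₁)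
open import Data.Fin.Subset using (Subset; _⊆_; ∣_∣)
open import Data.List using (List; length; filter)
open import Data.List.Membership.Propositional using (_∈_)
open import Data.List.Relation.Unary.Unique.Propositional using (Unique)
open import Data.Product using (Σ; _×_; ∃)
open import Relation.Binary.PropositionalEquality using (_≡_)

record MaximalChain (N : ℕ) : Set where
  field
    set  : Fin (suc N) → Subset N
    card : ∀ i → ∣ set i ∣ ≡ toℕ i
    incl : ∀ (i : Fin N) → set (inject₁ i) ⊆ set (Fin.suc i)

open MaximalChain public

IsCutset : (N : ℕ) → List (Subset N) → Set
IsCutset N C = (ch : MaximalChain N) → ∃ λ i → set ch i ∈ C

countSize : ∀ {N} → ℕ → List (Subset N) → ℕ
countSize i C = length (filter (λ A → ∣ A ∣ ≟ i) C)

Admissible : (N a b k : ℕ) → Set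
Admissible N a b k =
  Σ (List (Subset N)) λ C →
    Unique C ×
    IsCutset N C ×
    (∀ A → A ∈ C → a ≤ ∣ A ∣ × ∣ A ∣ ≤ b) ×
    (∀ i → a ≤ i → i ≤ b → countSize i C ≡ k)

IsG : (N a b k : ℕ) → Set
IsG N a b k = Admissible N a b k × (∀ j → Admissible N a b j → k ≤ j)

module Submission where

-- Let 𝒞 be a cutset of 2^[N], N = n − 1, with y sets on each level m, …, l, and let 0 be the extra
-- point of [N + 1]. The sets A and [N + 1] ∖ A for A ∈ 𝒞 (read with 0 ∉ A), together with y arbitrary
-- sets on each level l + 1, …, N − l, form a family with y sets on each level m, …, N + 1 − m; the
-- middle levels have room since y ≤ (N choose m) ≤ (N + 1 choose i) by unimodality of binomial
-- coefficients. It is a cutset: delete 0 from a maximal chain, and from its complementary chain; each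
-- resulting chain of 2^[N] meets 𝒞 at a level ≤ l, and 2l < n prevents both from containing 0 there.

open import Defs
open import Data.Nat using (ℕ; zero; suc; _+_; _*_; _∸_; _≤_; _<_; z≤n; s≤s; s≤s⁻¹; _⊓_; _≟_; _<?_)
open import Data.Nat.Properties
open import Data.Nat.Combinatorics using (_C_; nCk+nC[k+1]≡[n+1]C[k+1])
open import Data.Fin using (Fin; zero; suc; toℕ; inject₁; opposite)
open import Data.Fin.Properties using (toℕ-injective; toℕ-inject₁; opposite-prop; toℕ≤pred[n])
open import Data.Fin.Subset using (Subset; _⊆_; ∣_∣; ∁; inside; outside) renaming (_∉_ to _∉ₛ_)
open import Data.Fin.Subset.Properties using (drop-∷-⊆; x∈∁p⇒x∉p; p⊆q⇒∁p⊇∁q; ∣∁p∣≡n∸∣p∣; ∣p∣≤n; _∈?_)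
open import Data.Vec using ([]; _∷_) renaming (here to hereₛ)
open import Data.Vec.Properties using (∷-injectiveʳ)
open import Data.Bool.Properties using (not-involutive)
open import Data.List using (List; []; _∷_; _++_; map; take; length; filter)
open import Data.List.Properties using (filter-++; length-++; length-map; length-take; take++drop≡id; filter-all; filter-none; filter-accept; filter-reject)
import Data.List.Relation.Unary.All as All
open import Data.List.Relation.Unary.Unique.Propositional using (Unique; []; _∷_)
import Data.List.Relation.Unary.Unique.Propositional.Properties as Unique
open import Data.List.Membership.Propositional.Properties using (∈-map⁺; ∈-map⁻; ∈-++⁺ˡ; ∈-++⁺ʳ; ∈-++⁻; ∈-∃++; ∈-filter⁻)
open import Data.List.Relation.Unary.Any using (here; there)
open import Data.List.Membership.Propositional using (_∈_)
open import Data.List.Relation.Binary.Disjoint.Propositional using (Disjoint)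
open import Data.Empty using (⊥-elim)
open import Data.Product using (∃; _×_; _,_; proj₁; proj₂; map₁; map₂)
open import Data.Sum using (inj₁; inj₂)
open import Relation.Binary.PropositionalEquality
open import Relation.Nullary using (yes; no)
open import Function using (_∘_; id; _⇔_; mk⇔; Equivalence)
open Equivalence using (to; from)

module _ {N : ℕ} (ch : MaximalChain N) where

  set-mono-+ : ∀ d {i j} → toℕ j ≡ d + toℕ i → set ch i ⊆ set ch j
  set-mono-+ zero    {i} {j}     eq = subst (λ k → set ch i ⊆ set ch k) (toℕ-injective (sym eq)) id
  set-mono-+ (suc d) {i} {suc j} eq = incl ch j ∘ set-mono-+ d (trans (toℕ-inject₁ j) (suc-injective eq))

  set-mono : ∀ {i j} → toℕ i ≤ toℕ j → set ch i ⊆ set ch j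
  set-mono {i} {j} i≤j = set-mono-+ (toℕ j ∸ toℕ i) (sym (m∸n+n≡m i≤j))

opposite-inject₁ : ∀ {N} (j : Fin N) → opposite (inject₁ j) ≡ suc (opposite j)
opposite-inject₁ zero    = refl
opposite-inject₁ (suc j) = cong inject₁ (opposite-inject₁ j)

∁-involutive : ∀ {N} (A : Subset N) → ∁ (∁ A) ≡ A
∁-involutive []      = refl
∁-involutive (b ∷ A) = cong₂ _∷_ (not-involutive b) (∁-involutive A)

∁-injective : ∀ {N} {A B : Subset N} → ∁ A ≡ ∁ B → A ≡ B
∁-injective {A = A} {B} eq = trans (sym (∁-involutive A)) (trans (cong ∁ eq) (∁-involutive B))

complement : ∀ {N} → MaximalChain N → MaximalChain N
complement {N} ch = record
  { set  = λ j → ∁ (set ch (opposite j))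
  ; card = card′
  ; incl = λ j → subst (λ k → ∁ (set ch k) ⊆ ∁ (set ch (opposite (suc j)))) (sym (opposite-inject₁ j))
                   (p⊆q⇒∁p⊇∁q (incl ch (opposite j)))
  }
  where
  card′ : ∀ j → ∣ ∁ (set ch (opposite j)) ∣ ≡ toℕ j
  card′ j = begin
    ∣ ∁ (set ch (opposite j)) ∣    ≡⟨ ∣∁p∣≡n∸∣p∣ (set ch (opposite j)) ⟩
    N ∸ ∣ set ch (opposite j) ∣    ≡⟨ cong (N ∸_) (trans (card ch (opposite j)) (opposite-prop j)) ⟩
    N ∸ (N ∸ toℕ j)                ≡⟨ m∸[m∸n]≡n (toℕ≤pred[n] j) ⟩
    toℕ j                          ∎
    where open ≡-Reasoning

-- Level i of deleteZero: A_i ∖ {0} if 0 ∉ A_i, and A_{i+1} ∖ {0} otherwise.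
pick : ∀ {N} → Subset (suc N) → Subset (suc N) → Subset N
pick (outside ∷ a) _       = a
pick (inside ∷ _) (_ ∷ b) = b

pick-card : ∀ {N} {a b : Subset (suc N)} {i} → a ⊆ b → ∣ a ∣ ≡ i → ∣ b ∣ ≡ suc i → ∣ pick a b ∣ ≡ i
pick-card {a = outside ∷ a}                  _  ∣a∣≡i _      = ∣a∣≡i
pick-card {a = inside ∷ a} {inside ∷ b}     _  _     ∣b∣≡1+i = suc-injective ∣b∣≡1+i
pick-card {a = inside ∷ a} {outside ∷ b}    a⊆b _ _ with () ← a⊆b hereₛ

pick-⊆ : ∀ {N} {a b c : Subset (suc N)} → a ⊆ b → b ⊆ c → pick a b ⊆ pick b c
pick-⊆ {a = outside ∷ a} {outside ∷ b}             a⊆b _   = drop-∷-⊆ a⊆b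
pick-⊆ {a = outside ∷ a} {inside ∷ b}  {_ ∷ c}     a⊆b b⊆c = drop-∷-⊆ (b⊆c ∘ a⊆b)
pick-⊆ {a = inside ∷ a}  {inside ∷ b}  {_ ∷ c}     _   b⊆c = drop-∷-⊆ b⊆c
pick-⊆ {a = inside ∷ a}  {outside ∷ b}             a⊆b _ with () ← a⊆b hereₛ

deleteZero : ∀ {N} → MaximalChain (suc N) → MaximalChain N
deleteZero ch = record
  { set  = λ i → pick (set ch (inject₁ i)) (set ch (suc i))
  ; card = λ i → pick-card (incl ch i) (trans (card ch (inject₁ i)) (toℕ-inject₁ i)) (card ch (suc i))
  ; incl = λ i → pick-⊆ (incl ch (inject₁ i)) (incl ch (suc i))
  }

deleteZero-outside : ∀ {N} (ch : MaximalChain (suc N)) {i} → zero ∉ₛ set ch (inject₁ i) →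
                     set ch (inject₁ i) ≡ outside ∷ set (deleteZero ch) i
deleteZero-outside ch {i} 0∉ with set ch (inject₁ i)
... | outside ∷ a = refl
... | inside ∷ a  with () ← 0∉ hereₛ

inject₁≤opposite-inject₁ : ∀ {N l} {i j : Fin N} → toℕ i ≤ l → toℕ j ≤ l → l + l ≤ N →
                           toℕ (inject₁ i) ≤ toℕ (opposite (inject₁ j))
inject₁≤opposite-inject₁ {N} {l} {i} {j} i≤l j≤l l+l≤N = begin
  toℕ (inject₁ i)              ≡⟨ toℕ-inject₁ i ⟩
  toℕ i                        ≤⟨ m+n≤o⇒m≤o∸n (toℕ i) (≤-trans (+-mono-≤ i≤l j≤l) l+l≤N) ⟩
  N ∸ toℕ j                    ≡⟨ cong (N ∸_) (toℕ-inject₁ j) ⟨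
  N ∸ toℕ (inject₁ j)          ≡⟨ opposite-prop (inject₁ j) ⟨
  toℕ (opposite (inject₁ j))   ∎
  where open ≤-Reasoning

meet-level≤ : ∀ {N l} {𝒞 : List (Subset N)} → IsCutset N 𝒞 → (∀ {A} → A ∈ 𝒞 → ∣ A ∣ ≤ l) →
           (ch : MaximalChain N) → ∃ λ i → toℕ i ≤ l × set ch i ∈ 𝒞
meet-level≤ cut small ch with cut ch
... | i , Bᵢ∈𝒞 = i , subst (_≤ _) (card ch i) (small Bᵢ∈𝒞) , Bᵢ∈𝒞

-- A chain either avoids 0 at the level where it meets 𝒞 (and then meets outside ∷ 𝒞 there), or
-- its complement chain does; if both contained 0 then, as both levels are at most l ≤ N − l,
-- the chain would contain 0 at a level below one at which it avoids 0.
cutset-lift : ∀ {N l} {𝒞 : List (Subset N)} {𝒟 : List (Subset (suc N))} →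
              IsCutset N 𝒞 → (∀ {A} → A ∈ 𝒞 → ∣ A ∣ ≤ l) → l + l ≤ N →
              (∀ {A} → A ∈ 𝒞 → outside ∷ A ∈ 𝒟) → (∀ {A} → A ∈ 𝒞 → ∁ (outside ∷ A) ∈ 𝒟) →
              IsCutset (suc N) 𝒟
cutset-lift {N} {l} {𝒞} {𝒟} cut small l+l≤N outside∷∈𝒟 ∁outside∷∈𝒟 ch
  with meet-level≤ cut small (deleteZero ch)
... | i , i≤l , Bᵢ∈𝒞 with zero ∈? set ch (inject₁ i)
...   | no 0∉Aᵢ = inject₁ i , subst (_∈ 𝒟) (sym (deleteZero-outside ch 0∉Aᵢ)) (outside∷∈𝒟 Bᵢ∈𝒞)
...   | yes 0∈Aᵢ with meet-level≤ cut small (deleteZero (complement ch))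
...     | j , j≤l , Bⱼ∈𝒞 with zero ∈? set (complement ch) (inject₁ j)
...       | no 0∉∁Aₖ = opposite (inject₁ j) ,
                       subst (_∈ 𝒟) (trans (cong ∁ (sym (deleteZero-outside (complement ch) {j} 0∉∁Aₖ)))
                                           (∁-involutive _))
                             (∁outside∷∈𝒟 Bⱼ∈𝒞)
...       | yes 0∈∁Aₖ = ⊥-elim (x∈∁p⇒x∉p 0∈∁Aₖ (set-mono ch i≤k 0∈Aᵢ))
  where
  i≤k : toℕ (inject₁ i) ≤ toℕ (opposite (inject₁ j))
  i≤k = inject₁≤opposite-inject₁ i≤l j≤l (m≤n⇒m≤1+n l+l≤N)

countSize-++ : ∀ {N} i (𝒞 𝒟 : List (Subset N)) → countSize i (𝒞 ++ 𝒟) ≡ countSize i 𝒞 + countSize i 𝒟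
countSize-++ i 𝒞 𝒟 = trans (cong length (filter-++ (λ A → ∣ A ∣ ≟ i) 𝒞 𝒟)) (length-++ (filter (λ A → ∣ A ∣ ≟ i) 𝒞))

countSize-none : ∀ {N i} {𝒞 : List (Subset N)} → (∀ {A} → A ∈ 𝒞 → ∣ A ∣ ≢ i) → countSize i 𝒞 ≡ 0
countSize-none {i = i} h = cong length (filter-none (λ A → ∣ A ∣ ≟ i) (All.tabulate h))

countSize-all : ∀ {N i} {𝒞 : List (Subset N)} → (∀ {A} → A ∈ 𝒞 → ∣ A ∣ ≡ i) → countSize i 𝒞 ≡ length 𝒞
countSize-all {i = i} h = cong length (filter-all (λ A → ∣ A ∣ ≟ i) (All.tabulate h))

countSize-∷-accept : ∀ {N i} (A : Subset N) (𝒞 : List (Subset N)) → ∣ A ∣ ≡ i → countSize i (A ∷ 𝒞) ≡ suc (countSize i 𝒞)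
countSize-∷-accept {i = i} A 𝒞 ∣A∣≡i = cong length (filter-accept (λ B → ∣ B ∣ ≟ i) {A} {𝒞} ∣A∣≡i)

countSize-∷-reject : ∀ {N i} (A : Subset N) (𝒞 : List (Subset N)) → ∣ A ∣ ≢ i → countSize i (A ∷ 𝒞) ≡ countSize i 𝒞
countSize-∷-reject {i = i} A 𝒞 ∣A∣≢i = cong length (filter-reject (λ B → ∣ B ∣ ≟ i) {A} {𝒞} ∣A∣≢i)

countSize-map : ∀ {M N i j} (f : Subset M → Subset N) (𝒞 : List (Subset M)) →
                (∀ {A} → A ∈ 𝒞 → (∣ f A ∣ ≡ i) ⇔ (∣ A ∣ ≡ j)) → countSize i (map f 𝒞) ≡ countSize j 𝒞
countSize-map f []      _ = refl
countSize-map {i = i} {j} f (A ∷ 𝒞) f-preserves with ∣ A ∣ ≟ j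
... | yes ∣A∣≡j = begin
  countSize i (f A ∷ map f 𝒞)   ≡⟨ countSize-∷-accept (f A) (map f 𝒞) (from (f-preserves (here refl)) ∣A∣≡j) ⟩
  suc (countSize i (map f 𝒞))   ≡⟨ cong suc (countSize-map f 𝒞 (f-preserves ∘ there)) ⟩
  suc (countSize j 𝒞)           ≡⟨ countSize-∷-accept A 𝒞 ∣A∣≡j ⟨
  countSize j (A ∷ 𝒞)           ∎
  where open ≡-Reasoning
... | no ∣A∣≢j = begin
  countSize i (f A ∷ map f 𝒞)   ≡⟨ countSize-∷-reject (f A) (map f 𝒞) (∣A∣≢j ∘ to (f-preserves (here refl))) ⟩
  countSize i (map f 𝒞)         ≡⟨ countSize-map f 𝒞 (f-preserves ∘ there) ⟩
  countSize j 𝒞                 ≡⟨ countSize-∷-reject A 𝒞 ∣A∣≢j ⟨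
  countSize j (A ∷ 𝒞)           ∎
  where open ≡-Reasoning

-- Sizes range over the half-open interval [a, b), so that consecutive ranges concatenate.
record Uniform {N} (a b y : ℕ) (𝒞 : List (Subset N)) : Set where
  field
    unique : Unique 𝒞
    sizes  : ∀ {A} → A ∈ 𝒞 → a ≤ ∣ A ∣ × ∣ A ∣ < b
    counts : ∀ {i} → a ≤ i → i < b → countSize i 𝒞 ≡ y

open Uniform

Uniform-++ : ∀ {N a b c y} {𝒞 𝒟 : List (Subset N)} → a ≤ b → b ≤ c →
             Uniform a b y 𝒞 → Uniform b c y 𝒟 → Uniform a c y (𝒞 ++ 𝒟)
Uniform-++ _ _ U V .unique =
  Unique.++⁺ (unique U) (unique V) λ (A∈𝒞 , A∈𝒟) → <⇒≱ (proj₂ (sizes U A∈𝒞)) (proj₁ (sizes V A∈𝒟))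
Uniform-++ {𝒞 = 𝒞} a≤b b≤c U V .sizes A∈ with ∈-++⁻ 𝒞 A∈
... | inj₁ A∈𝒞 = map₂ (λ ∣A∣<b → <-≤-trans ∣A∣<b b≤c) (sizes U A∈𝒞)
... | inj₂ A∈𝒟 = map₁ (≤-trans a≤b) (sizes V A∈𝒟)
Uniform-++ {b = b} {y = y} {𝒞} {𝒟} _ _ U V .counts {i} a≤i i<c with i <? b
... | yes i<b = begin
  countSize i (𝒞 ++ 𝒟)           ≡⟨ countSize-++ i 𝒞 𝒟 ⟩
  countSize i 𝒞 + countSize i 𝒟   ≡⟨ cong₂ _+_ (counts U a≤i i<b) (countSize-none (λ A∈𝒟 ∣A∣≡i →
                                       <⇒≱ i<b (subst (b ≤_) ∣A∣≡i (proj₁ (sizes V A∈𝒟))))) ⟩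
  y + 0                           ≡⟨ +-identityʳ y ⟩
  y                               ∎
  where open ≡-Reasoning
... | no i≮b = begin
  countSize i (𝒞 ++ 𝒟)           ≡⟨ countSize-++ i 𝒞 𝒟 ⟩
  countSize i 𝒞 + countSize i 𝒟   ≡⟨ cong₂ _+_ (countSize-none (λ A∈𝒞 ∣A∣≡i →
                                       i≮b (subst (_< b) ∣A∣≡i (proj₂ (sizes U A∈𝒞)))))
                                     (counts V (≮⇒≥ i≮b) i<c) ⟩
  0 + y                           ≡⟨⟩
  y                               ∎
  where open ≡-Reasoning

Uniform-outside∷ : ∀ {N a b y} {𝒞 : List (Subset N)} →
                   Uniform a b y 𝒞 → Uniform a b y (map (outside ∷_) 𝒞)
Uniform-outside∷ U .unique = Unique.map⁺ ∷-injectiveʳ (unique U)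
Uniform-outside∷ U .sizes A∈ with ∈-map⁻ (outside ∷_) A∈
... | B , B∈𝒞 , refl = sizes U B∈𝒞
Uniform-outside∷ {𝒞 = 𝒞} U .counts a≤i i<b =
  trans (countSize-map (outside ∷_) 𝒞 (λ _ → mk⇔ id id)) (counts U a≤i i<b)

∣∁A∣≡i⇔∣A∣≡M∸i : ∀ {M i} (A : Subset M) → i ≤ M → (∣ ∁ A ∣ ≡ i) ⇔ (∣ A ∣ ≡ M ∸ i)
∣∁A∣≡i⇔∣A∣≡M∸i {M} {i} A i≤M = mk⇔
  (λ ∣∁A∣≡i → trans (sym (m∸[m∸n]≡n (∣p∣≤n A))) (cong (M ∸_) (trans (sym (∣∁p∣≡n∸∣p∣ A)) ∣∁A∣≡i)))
  (λ ∣A∣≡M∸i → trans (∣∁p∣≡n∸∣p∣ A) (trans (cong (M ∸_) ∣A∣≡M∸i) (m∸[m∸n]≡n i≤M)))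

reflect-range : ∀ {M a b s} → b ≤ suc M → a ≤ s → s < b → suc M ∸ b ≤ M ∸ s × M ∸ s < suc M ∸ a
reflect-range {M} {a} {b} {s} b≤1+M a≤s s<b = ∸-monoʳ-≤ (suc M) s<b , (begin-strict
  M ∸ s         <⟨ n<1+n (M ∸ s) ⟩
  suc (M ∸ s)   ≡⟨ +-∸-assoc 1 (s≤s⁻¹ (≤-trans s<b b≤1+M)) ⟨
  suc M ∸ s     ≤⟨ ∸-monoʳ-≤ (suc M) a≤s ⟩
  suc M ∸ a     ∎)
  where open ≤-Reasoning

Uniform-∁ : ∀ {M a b y} {𝒞 : List (Subset M)} → a ≤ b → b ≤ suc M →
            Uniform a b y 𝒞 → Uniform (suc M ∸ b) (suc M ∸ a) y (map ∁ 𝒞)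
Uniform-∁ _ _ U .unique = Unique.map⁺ ∁-injective (unique U)
Uniform-∁ _ b≤1+M U .sizes A∈ with ∈-map⁻ ∁ A∈
... | B , B∈𝒞 , refl = subst (λ s → _ ≤ s × s < _) (sym (∣∁p∣≡n∸∣p∣ B))
                         (reflect-range b≤1+M (proj₁ (sizes U B∈𝒞)) (proj₂ (sizes U B∈𝒞)))
Uniform-∁ {M} {a} {b} {𝒞 = 𝒞} a≤b b≤1+M U .counts {i} lo hi =
  trans (countSize-map ∁ 𝒞 (λ {A} _ → ∣∁A∣≡i⇔∣A∣≡M∸i A i≤M))
        (counts U (subst (_≤ M ∸ i) (m∸[m∸n]≡n a≤1+M) (proj₁ reflected))
                  (subst (M ∸ i <_) (m∸[m∸n]≡n b≤1+M) (proj₂ reflected)))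
  where
  a≤1+M : a ≤ suc M
  a≤1+M = ≤-trans a≤b b≤1+M

  i≤M : i ≤ M
  i≤M = s≤s⁻¹ (≤-trans hi (m∸n≤m (suc M) a))

  reflected : suc M ∸ (suc M ∸ a) ≤ M ∸ i × M ∸ i < suc M ∸ (suc M ∸ b)
  reflected = reflect-range (m∸n≤m (suc M) a) lo hi

layer : (N k : ℕ) → List (Subset N)
layer zero    zero    = [] ∷ []
layer zero    (suc k) = []
layer (suc N) zero    = map (outside ∷_) (layer N zero)
layer (suc N) (suc k) = map (inside ∷_) (layer N k) ++ map (outside ∷_) (layer N (suc k))

∈-layer⁻ : ∀ {N k A} → A ∈ layer N k → ∣ A ∣ ≡ k
∈-layer⁻ {zero}  {zero}  (here refl) = refl
∈-layer⁻ {suc N} {zero}  A∈ with ∈-map⁻ (outside ∷_) A∈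
... | B , B∈ , refl = ∈-layer⁻ B∈
∈-layer⁻ {suc N} {suc k} A∈ with ∈-++⁻ (map (inside ∷_) (layer N k)) A∈
... | inj₁ A∈ᵢ with ∈-map⁻ (inside ∷_) A∈ᵢ
...   | B , B∈ , refl = cong suc (∈-layer⁻ B∈)
∈-layer⁻ {suc N} {suc k} A∈ | inj₂ A∈ₒ with ∈-map⁻ (outside ∷_) A∈ₒ
...   | B , B∈ , refl = ∈-layer⁻ B∈

outside∷-∈-layer : ∀ {N k A} → A ∈ layer N k → outside ∷ A ∈ layer (suc N) k
outside∷-∈-layer {N} {zero}  A∈ = ∈-map⁺ (outside ∷_) A∈
outside∷-∈-layer {N} {suc k} A∈ = ∈-++⁺ʳ (map (inside ∷_) (layer N k)) (∈-map⁺ (outside ∷_) A∈)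

∈-layer⁺ : ∀ {N} (A : Subset N) → A ∈ layer N ∣ A ∣
∈-layer⁺ []            = here refl
∈-layer⁺ (inside ∷ A)  = ∈-++⁺ˡ (∈-map⁺ (inside ∷_) (∈-layer⁺ A))
∈-layer⁺ (outside ∷ A) = outside∷-∈-layer (∈-layer⁺ A)

inside∷-outside∷-disjoint : ∀ {N} {𝒜 ℬ : List (Subset N)} → Disjoint (map (inside ∷_) 𝒜) (map (outside ∷_) ℬ)
inside∷-outside∷-disjoint (A∈ᵢ , A∈ₒ) with ∈-map⁻ (inside ∷_) A∈ᵢ | ∈-map⁻ (outside ∷_) A∈ₒ
... | _ , _ , refl | _ , _ , ()

layer-unique : ∀ N k → Unique (layer N k)
layer-unique zero    zero    = All.[] ∷ []
layer-unique zero    (suc k) = []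
layer-unique (suc N) zero    = Unique.map⁺ ∷-injectiveʳ (layer-unique N zero)
layer-unique (suc N) (suc k) =
  Unique.++⁺ (Unique.map⁺ ∷-injectiveʳ (layer-unique N k)) (Unique.map⁺ ∷-injectiveʳ (layer-unique N (suc k)))
    inside∷-outside∷-disjoint

length-layer : ∀ N k → length (layer N k) ≡ N C k
length-layer zero    zero    = refl
length-layer zero    (suc k) = refl
length-layer (suc N) zero    = trans (length-map (outside ∷_) (layer N zero)) (length-layer N zero)
length-layer (suc N) (suc k) = begin
  length (map (inside ∷_) (layer N k) ++ map (outside ∷_) (layer N (suc k)))
    ≡⟨ length-++ (map (inside ∷_) (layer N k)) ⟩
  length (map (inside ∷_) (layer N k)) + length (map (outside ∷_) (layer N (suc k)))
    ≡⟨ cong₂ _+_ (length-map (inside ∷_) (layer N k)) (length-map (outside ∷_) (layer N (suc k))) ⟩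
  length (layer N k) + length (layer N (suc k))
    ≡⟨ cong₂ _+_ (length-layer N k) (length-layer N (suc k)) ⟩
  N C k + N C suc k
    ≡⟨ nCk+nC[k+1]≡[n+1]C[k+1] N k ⟩
  suc N C suc k
    ∎
  where open ≡-Reasoning

unique-⊆⇒length≤ : ∀ {A : Set} {xs ys : List A} → Unique xs → (∀ {z} → z ∈ xs → z ∈ ys) → length xs ≤ length ys
unique-⊆⇒length≤ [] _ = z≤n
unique-⊆⇒length≤ {xs = x ∷ xs} (x∉xs ∷ xs-unique) xs⊆ys with ∈-∃++ (xs⊆ys (here refl))
... | us , vs , refl = begin
  suc (length xs)             ≤⟨ s≤s (unique-⊆⇒length≤ xs-unique xs⊆us++vs) ⟩
  suc (length (us ++ vs))     ≡⟨ cong suc (length-++ us) ⟩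
  suc (length us + length vs) ≡⟨ +-suc (length us) (length vs) ⟨
  length us + length (x ∷ vs) ≡⟨ length-++ us ⟨
  length (us ++ x ∷ vs)       ∎
  where
  open ≤-Reasoning
  xs⊆us++vs : ∀ {z} → z ∈ xs → z ∈ us ++ vs
  xs⊆us++vs z∈xs with ∈-++⁻ us (xs⊆ys (there z∈xs))
  ... | inj₁ z∈us         = ∈-++⁺ˡ z∈us
  ... | inj₂ (here z≡x)   = ⊥-elim (All.lookup x∉xs z∈xs (sym z≡x))
  ... | inj₂ (there z∈vs) = ∈-++⁺ʳ us z∈vs

countSize≤binomial : ∀ {N} k {𝒞 : List (Subset N)} → Unique 𝒞 → countSize k 𝒞 ≤ N C k
countSize≤binomial {N} k {𝒞} 𝒞-unique = subst (countSize k 𝒞 ≤_) (length-layer N k)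
  (unique-⊆⇒length≤ (Unique.filter⁺ (λ A → ∣ A ∣ ≟ k) 𝒞-unique) filtered⊆layer)
  where
  filtered⊆layer : ∀ {A} → A ∈ filter (λ B → ∣ B ∣ ≟ k) 𝒞 → A ∈ layer N k
  filtered⊆layer {A} A∈ = subst (λ j → A ∈ layer N j) (proj₂ (∈-filter⁻ (λ B → ∣ B ∣ ≟ k) {xs = 𝒞} A∈)) (∈-layer⁺ A)

k≤n⇒0<nCk : ∀ {n k} → k ≤ n → 0 < n C k
k≤n⇒0<nCk {n}     {zero}  _         = s≤s z≤n
k≤n⇒0<nCk {suc n} {suc k} (s≤s k≤n) =
  subst (0 <_) (nCk+nC[k+1]≡[n+1]C[k+1] n k) (<-≤-trans (k≤n⇒0<nCk k≤n) (m≤m+n (n C k) (n C suc k)))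

-- Unimodality of the binomial coefficients: the hypotheses say j ≤ k ≤ n − j.
nCj≤nCk : ∀ {n j k} → j ≤ k → j + k ≤ n → n C j ≤ n C k
nCj≤nCk {n}     {zero}          _          k≤n = k≤n⇒0<nCk k≤n
nCj≤nCk {suc n} {suc j} {suc k} (s≤s j≤k) (s≤s j+1+k≤n) with m≤n⇒m<n∨m≡n j≤k
... | inj₂ refl = ≤-refl
... | inj₁ j<k  = begin
  suc n C suc j         ≡⟨ nCk+nC[k+1]≡[n+1]C[k+1] n j ⟨
  n C j + n C suc j     ≤⟨ +-mono-≤ (nCj≤nCk (m≤n⇒m≤1+n j≤k) j+1+k≤n)
                                    (nCj≤nCk j<k (subst (_≤ n) (+-suc j k) j+1+k≤n)) ⟩
  n C suc k + n C k     ≡⟨ +-comm (n C suc k) (n C k) ⟩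
  n C k + n C suc k     ≡⟨ nCk+nC[k+1]≡[n+1]C[k+1] n k ⟩
  suc n C suc k         ∎
  where open ≤-Reasoning

nCk≤[1+n]Ck : ∀ n k → n C k ≤ suc n C k
nCk≤[1+n]Ck n zero    = ≤-refl
nCk≤[1+n]Ck n (suc k) = subst (n C suc k ≤_) (nCk+nC[k+1]≡[n+1]C[k+1] n k) (m≤n+m (n C suc k) (n C k))

∈-take : ∀ {A : Set} {z : A} n xs → z ∈ take n xs → z ∈ xs
∈-take n xs z∈ = subst (_ ∈_) (take++drop≡id n xs) (∈-++⁺ˡ z∈)

Uniform-take-layer : ∀ {N k y} → y ≤ N C k → Uniform k (suc k) y (take y (layer N k))
Uniform-take-layer {N} {k} {y} _ .unique = Unique.take⁺ y (layer-unique N k)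
Uniform-take-layer {N} {k} {y} _ .sizes A∈ with ∈-layer⁻ (∈-take y (layer N k) A∈)
... | refl = ≤-refl , ≤-refl
Uniform-take-layer {N} {k} {y} y≤nCk .counts k≤i i<1+k with ≤-antisym (s≤s⁻¹ i<1+k) k≤i
... | refl = begin
  countSize k (take y (layer N k))   ≡⟨ countSize-all (∈-layer⁻ ∘ ∈-take y (layer N k)) ⟩
  length (take y (layer N k))        ≡⟨ length-take y (layer N k) ⟩
  y ⊓ length (layer N k)             ≡⟨ m≤n⇒m⊓n≡m (subst (y ≤_) (sym (length-layer N k)) y≤nCk) ⟩
  y                                  ∎
  where open ≡-Reasoning

band : (N y a d : ℕ) → List (Subset N)
band N y a zero    = []
band N y a (suc d) = band N y a d ++ take y (layer N (d + a))

Uniform-band : ∀ {N y a} d → (∀ {i} → a ≤ i → i < d + a → y ≤ N C i) → Uniform a (d + a) y (band N y a d)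
Uniform-band zero    _     .unique = []
Uniform-band zero    _     .sizes  ()
Uniform-band zero    _     .counts a≤i i<a = ⊥-elim (<⇒≱ i<a a≤i)
Uniform-band {a = a} (suc d) y≤nCi =
  Uniform-++ (m≤n+m a d) (n≤1+n (d + a))
    (Uniform-band d (λ a≤i i<d+a → y≤nCi a≤i (m<n⇒m<1+n i<d+a)))
    (Uniform-take-layer (y≤nCi (m≤n+m a d) (n<1+n (d + a))))

Admissible⇒Uniform : ∀ {N a b y} → Admissible N a b y → ∃ λ 𝒞 → IsCutset N 𝒞 × Uniform a (suc b) y 𝒞
Admissible⇒Uniform (𝒞 , 𝒞-unique , 𝒞-cut , 𝒞-sizes , 𝒞-counts) = 𝒞 , 𝒞-cut , record
  { unique = 𝒞-unique
  ; sizes  = λ A∈ → map₂ s≤s (𝒞-sizes _ A∈)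
  ; counts = λ a≤i i<1+b → 𝒞-counts _ a≤i (s≤s⁻¹ i<1+b)
  }

Uniform⇒Admissible : ∀ {N a b y} {𝒞 : List (Subset N)} → IsCutset N 𝒞 → Uniform a (suc b) y 𝒞 → Admissible N a b y
Uniform⇒Admissible {𝒞 = 𝒞} 𝒞-cut U =
  𝒞 , unique U , 𝒞-cut , (λ _ A∈ → map₂ s≤s⁻¹ (sizes U A∈)) , λ _ a≤i i≤b → counts U a≤i (s≤s i≤b)

admissible-step : ∀ {N m l y} → m ≤ l → l + l ≤ N → Admissible N m l y → Admissible (suc N) m (suc N ∸ m) y
admissible-step {N} {m} {l} {y} m≤l l+l≤N adm with Admissible⇒Uniform adm
... | 𝒞 , 𝒞-cut , U = Uniform⇒Admissible
  (cutset-lift 𝒞-cut (s≤s⁻¹ ∘ proj₂ ∘ sizes U) l+l≤N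
    (∈-++⁺ˡ ∘ ∈-++⁺ˡ ∘ ∈-map⁺ (outside ∷_))
    (∈-++⁺ʳ (F ++ B) ∘ ∈-map⁺ ∁ ∘ ∈-map⁺ (outside ∷_)))
  (subst (λ b → Uniform m b y ((F ++ B) ++ map ∁ F)) (+-∸-assoc 1 m≤1+N) 𝒟-uniform)
  where
  l≤N : l ≤ N
  l≤N = m+n≤o⇒m≤o l l+l≤N

  m≤1+N : m ≤ suc N
  m≤1+N = m≤n⇒m≤1+n (≤-trans m≤l l≤N)

  m≤1+l : m ≤ suc l
  m≤1+l = m≤n⇒m≤1+n m≤l

  1+l≤1+N∸l : suc l ≤ suc N ∸ l
  1+l≤1+N∸l = subst (suc l ≤_) (sym (+-∸-assoc 1 l≤N)) (s≤s (m+n≤o⇒m≤o∸n l l+l≤N))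

  F B : List (Subset (suc N))
  F = map (outside ∷_) 𝒞
  B = band (suc N) y (suc l) (suc N ∸ l ∸ suc l)

  y≤binomial : ∀ {i} → suc l ≤ i → i < suc N ∸ l → y ≤ suc N C i
  y≤binomial {i} l<i i<1+N∸l = begin
    y              ≡⟨ counts U ≤-refl (s≤s m≤l) ⟨
    countSize m 𝒞  ≤⟨ countSize≤binomial m (unique U) ⟩
    N C m          ≤⟨ nCj≤nCk (<⇒≤ (≤-<-trans m≤l l<i)) m+i≤N ⟩
    N C i          ≤⟨ nCk≤[1+n]Ck N i ⟩
    suc N C i      ∎
    where
    open ≤-Reasoning
    m+i≤N : m + i ≤ N
    m+i≤N = begin
      m + i   ≤⟨ +-monoˡ-≤ i m≤l ⟩
      l + i   ≡⟨ +-comm l i ⟩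
      i + l   ≤⟨ s≤s⁻¹ (m≤o∸n⇒m+n≤o (suc i) (m≤n⇒m≤1+n l≤N) i<1+N∸l) ⟩
      N       ∎

  B-uniform : Uniform (suc l) (suc N ∸ l) y B
  B-uniform = subst (λ b → Uniform (suc l) b y B) (m∸n+n≡m 1+l≤1+N∸l)
    (Uniform-band (suc N ∸ l ∸ suc l) (λ {i} l<i i< → y≤binomial l<i (subst (i <_) (m∸n+n≡m 1+l≤1+N∸l) i<)))

  𝒟-uniform : Uniform m (suc (suc N) ∸ m) y ((F ++ B) ++ map ∁ F)
  𝒟-uniform = Uniform-++ (≤-trans m≤1+l 1+l≤1+N∸l) (∸-monoʳ-≤ (suc (suc N)) m≤1+l)
    (Uniform-++ m≤1+l 1+l≤1+N∸l (Uniform-outside∷ U) B-uniform)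
    (Uniform-∁ m≤1+l (s≤s (m≤n⇒m≤1+n l≤N)) (Uniform-outside∷ U))

proposition7 : (n m l : ℕ) → m ≤ l → 2 * l < n →
    (x y : ℕ) → IsG n m (n ∸ m) x → IsG (n ∸ 1) m l y → x ≤ y
proposition7 zero    _ _ _   ()
proposition7 (suc N) m l m≤l 2l<1+N x y (_ , x-least) (y-admissible , _) =
  x-least y (admissible-step m≤l l+l≤N y-admissible)
  where
  l+l≤N : l + l ≤ N
  l+l≤N = subst (_≤ N) (cong (l +_) (+-identityʳ l)) (s≤s⁻¹ 2l<1+N)
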